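{- Every existentially closed co-Brouwerian semilattice $L$ satisfies the Splitting Axiom: for all $a,b_1,b_2\in L$ with $b_1\vee b_2\ll a\neq 0$ there exist $a_1,a_2\in L$, both different from $0$, such that $a-a_1=a_2\ge b_2$, $a-a_2=a_1\ge b_1$, $b_2-a_1=b_2-b_1$ and $b_1-a_2=b_1-b_2$.
   Context: A co-Brouwerian semilattice (CBS) is a poset with least element $0$, binary joins $\vee$ and a difference $-$ characterized by $a-b\le c$ iff $a\le b\vee c$. $a\ll b$ means $a\le b$ and $b-a=b$. A CBS $L$ is existentially closed if for every CBS $B\supseteq L$ (superstructure in signature $(0,\vee,-)$), every existential sentence with parameters in $L$ true in $B$ is true in $L$. -}

module Defs where

open import Level using (Level; suc; _⊔_)
open import Data.Nat using (ℕ)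
open import Data.Fin using (Fin)
open import Data.Product using (Σ; _×_; _,_)
open import Data.Sum using (_⊎_)
open import Relation.Nullary using (¬_)
open import Relation.Binary.PropositionalEquality using (_≡_)
open import Function using (_⇔_)

record CBS (c : Level) : Set (suc c) where
  infixl 6 _∨_ _-_
  infix 4 _≤_
  field
    Carrier : Set c
    𝟎   : Carrier
    _∨_ : Carrier → Carrier → Carrier
    _-_ : Carrier → Carrier → Carrier

  _≤_ : Carrier → Carrier → Set c
  x ≤ y = x ∨ y ≡ y

  field
    ∨-assoc : ∀ x y z → (x ∨ y) ∨ z ≡ x ∨ (y ∨ z)
    ∨-comm  : ∀ x y → x ∨ y ≡ y ∨ x
    ∨-idem  : ∀ x → x ∨ x ≡ x
    𝟎-least : ∀ x → 𝟎 ≤ x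
    residuation : ∀ a b c → (a - b ≤ c) ⇔ (a ≤ b ∨ c)

  _≪_ : Carrier → Carrier → Set c
  a ≪ b = (a ≤ b) × (b - a ≡ b)

open CBS using (Carrier; 𝟎)

record Embedding {c : Level} (L B : CBS c) : Set c where
  field
    f        : Carrier L → Carrier B
    injective : ∀ x y → f x ≡ f y → x ≡ y
    pres-𝟎   : f (𝟎 L) ≡ 𝟎 B
    pres-∨   : ∀ x y → f (CBS._∨_ L x y) ≡ CBS._∨_ B (f x) (f y)
    pres-−   : ∀ x y → f (CBS._-_ L x y) ≡ CBS._-_ B (f x) (f y)

data Term {c : Level} (A : Set c) (n : ℕ) : Set c where
  var : Fin n → Term A n
  par : A → Term A n
  t𝟎  : Term A n
  _t∨_ : Term A n → Term A n → Term A n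
  _t-_ : Term A n → Term A n → Term A n

data QF {c : Level} (A : Set c) (n : ℕ) : Set c where
  _≐_  : Term A n → Term A n → QF A n
  ⊤f   : QF A n
  ⊥f   : QF A n
  ¬f_  : QF A n → QF A n
  _∧f_ : QF A n → QF A n → QF A n
  _∨f_ : QF A n → QF A n → QF A n

⟦_⟧t : ∀ {c n} {A : Set c} → Term A n → (B : CBS c) → (A → Carrier B) → (Fin n → Carrier B) → Carrier B
⟦ var i ⟧t B p ρ = ρ i
⟦ par a ⟧t B p ρ = p a
⟦ t𝟎 ⟧t B p ρ = 𝟎 B
⟦ s t∨ t ⟧t B p ρ = CBS._∨_ B (⟦ s ⟧t B p ρ) (⟦ t ⟧t B p ρ)
⟦ s t- t ⟧t B p ρ = CBS._-_ B (⟦ s ⟧t B p ρ) (⟦ t ⟧t B p ρ)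

open import Data.Unit.Polymorphic using (⊤)
open import Data.Empty.Polymorphic using (⊥)

Sat : ∀ {c n} {A : Set c} → QF A n → (B : CBS c) → (A → Carrier B) → (Fin n → Carrier B) → Set c
Sat (s ≐ t) B p ρ = ⟦ s ⟧t B p ρ ≡ ⟦ t ⟧t B p ρ
Sat ⊤f B p ρ = ⊤
Sat ⊥f B p ρ = ⊥
Sat (¬f φ) B p ρ = ¬ Sat φ B p ρ
Sat (φ ∧f ψ) B p ρ = Sat φ B p ρ × Sat ψ B p ρ
Sat (φ ∨f ψ) B p ρ = Sat φ B p ρ ⊎ Sat ψ B p ρ

SatEx : ∀ {c n} {A : Set c} → QF A n → (B : CBS c) → (A → Carrier B) → Set c
SatEx {n = n} φ B p = Σ (Fin n → Carrier B) (λ ρ → Sat φ B p ρ)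

ExistentiallyClosed : ∀ {c} → CBS c → Set (suc c)
ExistentiallyClosed {c} L =
  (B : CBS c) (e : Embedding L B) (n : ℕ) (φ : QF (Carrier L) n) →
  SatEx φ B (Embedding.f e) → SatEx φ L (λ x → x)

SplittingAxiom : ∀ {c} → CBS c → Set c
SplittingAxiom L =
  ∀ a b₁ b₂ → (b₁ ∨ b₂) ≪ a → ¬ (a ≡ 𝟎 L) →
  Σ (Carrier L) (λ a₁ → Σ (Carrier L) (λ a₂ →
    ¬ (a₁ ≡ 𝟎 L) × ¬ (a₂ ≡ 𝟎 L) ×
    (a - a₁ ≡ a₂) × (b₂ ≤ a₂) ×
    (a - a₂ ≡ a₁) × (b₁ ≤ a₁) ×
    (b₂ - a₁ ≡ b₂ - b₁) × (b₁ - a₂ ≡ b₁ - b₂)))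
  where open CBS L using (_∨_; _-_; _≤_; _≪_)

-- Given b₁ ∨ b₂ ≪ a, enlarge L to the CBS of triples (z, x, y) with x ∨ y ≤ z,
-- into which L embeds by x ↦ (x, x - b₁, x - b₂).  There a splits as
-- a₁ = (a, 𝟎, a) and a₂ = (a, a, 𝟎): the middle component sees b₂ but not b₁
-- (b₁ - b₁ = 𝟎) and the last one sees b₁ but not b₂, while a - bᵢ = a keeps
-- a visible in both.  The splitting conditions form an existential sentence
-- with parameters a, b₁, b₂, so existential closedness pulls a splitting back
-- into L.
module Submission where

open import Level using (Level)
open import Axiom.UniquenessOfIdentityProofs.WithK using (uip)
open import Data.Fin using (Fin; zero; suc)
open import Data.Product using (_,_; proj₁; proj₂)
open import Function using (_∘_; _⇔_; Equivalence; mk⇔)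
open import Relation.Binary.PropositionalEquality
open import Defs

module Properties {c : Level} (L : CBS c) where
  open CBS L

  ≤-refl : ∀ {x} → x ≤ x
  ≤-refl {x} = ∨-idem x

  ≤-reflexive : ∀ {x y} → x ≡ y → x ≤ y
  ≤-reflexive refl = ≤-refl

  ≤-trans : ∀ {x y z} → x ≤ y → y ≤ z → x ≤ z
  ≤-trans {x} {y} {z} x≤y y≤z = begin
    x ∨ z        ≡⟨ cong (x ∨_) (sym y≤z) ⟩
    x ∨ (y ∨ z)  ≡⟨ sym (∨-assoc x y z) ⟩
    (x ∨ y) ∨ z  ≡⟨ cong (_∨ z) x≤y ⟩
    y ∨ z        ≡⟨ y≤z ⟩
    z            ∎
    where open ≡-Reasoning

  ≤-antisym : ∀ {x y} → x ≤ y → y ≤ x → x ≡ y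
  ≤-antisym {x} {y} x≤y y≤x = trans (sym y≤x) (trans (∨-comm y x) x≤y)

  x≤x∨y : ∀ {x y} → x ≤ x ∨ y
  x≤x∨y {x} {y} = trans (sym (∨-assoc x x y)) (cong (_∨ y) (∨-idem x))

  y≤x∨y : ∀ {x y} → y ≤ x ∨ y
  y≤x∨y {x} {y} = subst (y ≤_) (∨-comm y x) x≤x∨y

  ∨-least : ∀ {x y z} → x ≤ z → y ≤ z → x ∨ y ≤ z
  ∨-least {x} {y} {z} x≤z y≤z = trans (∨-assoc x y z) (trans (cong (x ∨_) y≤z) x≤z)

  ∨-monoˡ-≤ : ∀ {x y} z → x ≤ y → x ∨ z ≤ y ∨ z
  ∨-monoˡ-≤ z x≤y = ∨-least (≤-trans x≤y x≤x∨y) y≤x∨y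

  ∨-identityˡ : ∀ x → 𝟎 ∨ x ≡ x
  ∨-identityˡ = 𝟎-least

  ∨-identityʳ : ∀ x → x ∨ 𝟎 ≡ x
  ∨-identityʳ x = trans (∨-comm x 𝟎) (∨-identityˡ x)

  -⇒≤ : ∀ {x y z} → x - y ≤ z → x ≤ y ∨ z
  -⇒≤ {x} {y} {z} = Equivalence.to (residuation x y z)

  ≤⇒- : ∀ {x y z} → x ≤ y ∨ z → x - y ≤ z
  ≤⇒- {x} {y} {z} = Equivalence.from (residuation x y z)

  x≤y∨[x-y] : ∀ {x y} → x ≤ y ∨ (x - y)
  x≤y∨[x-y] = -⇒≤ ≤-refl

  x-y≤x : ∀ {x y} → x - y ≤ x
  x-y≤x = ≤⇒- y≤x∨y

  x≤y⇒x-y≤z : ∀ {x y z} → x ≤ y → x - y ≤ z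
  x≤y⇒x-y≤z x≤y = ≤⇒- (≤-trans x≤y x≤x∨y)

  x≤y⇒x-y≡𝟎 : ∀ {x y} → x ≤ y → x - y ≡ 𝟎
  x≤y⇒x-y≡𝟎 x≤y = ≤-antisym (x≤y⇒x-y≤z x≤y) (𝟎-least _)

  x-x≡𝟎 : ∀ {x} → x - x ≡ 𝟎
  x-x≡𝟎 = x≤y⇒x-y≡𝟎 ≤-refl

  [x-x]-y≡𝟎 : ∀ {x y} → (x - x) - y ≡ 𝟎
  [x-x]-y≡𝟎 = x≤y⇒x-y≡𝟎 (≤-trans (≤-reflexive x-x≡𝟎) (𝟎-least _))

  x-𝟎≡x : ∀ {x} → x - 𝟎 ≡ x
  x-𝟎≡x = ≤-antisym x-y≤x (≤-trans x≤y∨[x-y] (≤-reflexive (∨-identityˡ _)))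

  diff-antitoneʳ : ∀ {x y z} → y ≤ z → x - z ≤ x - y
  diff-antitoneʳ {x} {y} {z} y≤z = ≤⇒- (≤-trans x≤y∨[x-y] (∨-monoˡ-≤ (x - y) y≤z))

  diff-distribʳ-∨ : ∀ x y z → (x ∨ y) - z ≡ (x - z) ∨ (y - z)
  diff-distribʳ-∨ x y z = ≤-antisym
    (≤⇒- (∨-least (-⇒≤ x≤x∨y) (-⇒≤ y≤x∨y)))
    (∨-least (diff-monoˡ x≤x∨y) (diff-monoˡ y≤x∨y))
    where
    diff-monoˡ : ∀ {u v} → u ≤ v → u - z ≤ v - z
    diff-monoˡ u≤v = ≤⇒- (≤-trans u≤v x≤y∨[x-y])

  [x-y]-z≡x-[y∨z] : ∀ x y z → (x - y) - z ≡ x - (y ∨ z)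
  [x-y]-z≡x-[y∨z] x y z = ≤-antisym
    (≤⇒- (≤⇒- (subst (x ≤_) (∨-assoc y z _) x≤y∨[x-y])))
    (≤⇒- (subst (x ≤_) (sym (∨-assoc y z _)) (-⇒≤ x≤y∨[x-y])))

  [x-y]-y≡x-y : ∀ x y → (x - y) - y ≡ x - y
  [x-y]-y≡x-y x y = trans ([x-y]-z≡x-[y∨z] x y y) (cong (x -_) (∨-idem y))

  [x-z]-[y-z]≡[x-y]-z : ∀ x y z → (x - z) - (y - z) ≡ (x - y) - z
  [x-z]-[y-z]≡[x-y]-z x y z = begin
    (x - z) - (y - z)  ≡⟨ [x-y]-z≡x-[y∨z] x z (y - z) ⟩
    x - (z ∨ (y - z))  ≡⟨ cong (x -_) z∨[y-z]≡y∨z ⟩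
    x - (y ∨ z)        ≡⟨ sym ([x-y]-z≡x-[y∨z] x y z) ⟩
    (x - y) - z        ∎
    where
    open ≡-Reasoning
    z∨[y-z]≡y∨z : z ∨ (y - z) ≡ y ∨ z
    z∨[y-z]≡y∨z = ≤-antisym
      (∨-least y≤x∨y (≤-trans x-y≤x x≤x∨y))
      (∨-least x≤y∨[x-y] x≤x∨y)

  ≤-≪-trans : ∀ {x y z} → x ≤ y → y ≪ z → x ≪ z
  ≤-≪-trans {x} {y} {z} x≤y (y≤z , z-y≡z) =
    ≤-trans x≤y y≤z , ≤-antisym x-y≤x (subst (_≤ z - x) z-y≡z (diff-antitoneʳ x≤y))

module Dominated {c : Level} (L : CBS c) where
  open CBS L
  open Properties L

  record Triple : Set c where
    constructor triple
    field
      top left right : Carrier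
      bounded : left ∨ right ≤ top
  open Triple public

  Triple-≡ : ∀ {r s} → top r ≡ top s → left r ≡ left s → right r ≡ right s → r ≡ s
  Triple-≡ {triple z x y p} {triple .z .x .y q} refl refl refl = cong (triple z x y) (uip p q)

  left≤top : ∀ r → left r ≤ top r
  left≤top r = ≤-trans x≤x∨y (bounded r)

  right≤top : ∀ r → right r ≤ top r
  right≤top r = ≤-trans y≤x∨y (bounded r)

  tight : Carrier → Carrier → Triple
  tight x y = triple (x ∨ y) x y ≤-refl

  infixl 6 _∨ᵀ_ _-ᵀ_
  infix 4 _≤ᵀ_

  _∨ᵀ_ : Triple → Triple → Triple
  r ∨ᵀ s = triple (top r ∨ top s) (left r ∨ left s) (right r ∨ right s)
    (∨-least (∨-least (≤-trans (left≤top r) x≤x∨y) (≤-trans (left≤top s) y≤x∨y))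
             (∨-least (≤-trans (right≤top r) x≤x∨y) (≤-trans (right≤top s) y≤x∨y)))

  -- The componentwise difference need not be a triple: its top is enlarged
  -- just enough to dominate the other two components.
  _-ᵀ_ : Triple → Triple → Triple
  r -ᵀ s = triple ((top r - top s) ∨ ((left r - left s) ∨ (right r - right s)))
    (left r - left s) (right r - right s) y≤x∨y

  𝟎ᵀ : Triple
  𝟎ᵀ = triple 𝟎 𝟎 𝟎 (∨-least ≤-refl ≤-refl)

  residuationᵀ : ∀ r s t → (r -ᵀ s ∨ᵀ t ≡ t) ⇔ (r ∨ᵀ (s ∨ᵀ t) ≡ s ∨ᵀ t)
  residuationᵀ r s t = mk⇔ to from
    where
    to : r -ᵀ s ∨ᵀ t ≡ t → r ∨ᵀ (s ∨ᵀ t) ≡ s ∨ᵀ t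
    to eq = Triple-≡ (-⇒≤ (≤-trans x≤x∨y (cong top eq))) (-⇒≤ (cong left eq)) (-⇒≤ (cong right eq))
    from : r ∨ᵀ (s ∨ᵀ t) ≡ s ∨ᵀ t → r -ᵀ s ∨ᵀ t ≡ t
    from eq = Triple-≡
      (∨-least (≤⇒- (cong top eq))
               (∨-least (≤-trans (≤⇒- (cong left eq)) (left≤top t))
                        (≤-trans (≤⇒- (cong right eq)) (right≤top t))))
      (≤⇒- (cong left eq)) (≤⇒- (cong right eq))

  dominated : CBS c
  dominated = record
    { Carrier     = Triple
    ; 𝟎           = 𝟎ᵀ
    ; _∨_         = _∨ᵀ_
    ; _-_         = _-ᵀ_
    ; ∨-assoc     = λ _ _ _ → Triple-≡ (∨-assoc _ _ _) (∨-assoc _ _ _) (∨-assoc _ _ _)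
    ; ∨-comm      = λ _ _ → Triple-≡ (∨-comm _ _) (∨-comm _ _) (∨-comm _ _)
    ; ∨-idem      = λ _ → Triple-≡ (∨-idem _) (∨-idem _) (∨-idem _)
    ; 𝟎-least     = λ _ → Triple-≡ (𝟎-least _) (𝟎-least _) (𝟎-least _)
    ; residuation = residuationᵀ
    }

  tight≢𝟎ᵀ : ∀ {x y} → x ∨ y ≢ 𝟎 → tight x y ≢ 𝟎ᵀ
  tight≢𝟎ᵀ x∨y≢𝟎 = x∨y≢𝟎 ∘ cong top

  _≤ᵀ_ : Triple → Triple → Set c
  _≤ᵀ_ = CBS._≤_ dominated

  ≤ᵀ-componentwise : ∀ {r s} → top r ≤ top s → left r ≤ left s → right r ≤ right s → r ≤ᵀ s
  ≤ᵀ-componentwise = Triple-≡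

  triple≡tight : ∀ {z x y} (p : x ∨ y ≤ z) → z ≤ x ∨ y → triple z x y p ≡ tight x y
  triple≡tight p z≤x∨y = Triple-≡ (≤-antisym z≤x∨y p) refl refl

  -ᵀ-tight : ∀ r s → top r ≤ top s → r -ᵀ s ≡ tight (left r - left s) (right r - right s)
  -ᵀ-tight r s top≤top = triple≡tight y≤x∨y (∨-least (x≤y⇒x-y≤z top≤top) ≤-refl)

  differences : Carrier → Carrier → Carrier → Triple
  differences u v x = triple x (x - u) (x - v) (∨-least x-y≤x x-y≤x)

  differences-− : ∀ u v x y → differences u v (x - y) ≡ differences u v x -ᵀ differences u v y
  differences-− u v x y = Triple-≡
    (sym (trans (∨-comm _ _) (∨-least (shadow≤ u) (shadow≤ v))))
    (sym ([x-z]-[y-z]≡[x-y]-z x y u)) (sym ([x-z]-[y-z]≡[x-y]-z x y v))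
    where
    shadow≤ : ∀ w → (x - w) - (y - w) ≤ x - y
    shadow≤ w = ≤-trans (≤-reflexive ([x-z]-[y-z]≡[x-y]-z x y w)) x-y≤x

  differencesEmbedding : ∀ u v → Embedding L dominated
  differencesEmbedding u v = record
    { f         = differences u v
    ; injective = λ _ _ → cong top
    ; pres-𝟎    = Triple-≡ refl (x≤y⇒x-y≡𝟎 (𝟎-least u)) (x≤y⇒x-y≡𝟎 (𝟎-least v))
    ; pres-∨    = λ x y → Triple-≡ refl (diff-distribʳ-∨ x y u) (diff-distribʳ-∨ x y v)
    ; pres-−    = differences-− u v
    }

infixr 3 _∧_
infix 4 _≼_

_∧_ : ∀ {c n} {A : Set c} → QF A n → QF A n → QF A n
_∧_ = _∧f_

_≼_ : ∀ {c n} {A : Set c} → Term A n → Term A n → QF A n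
s ≼ t = (s t∨ t) ≐ t

nonzero : ∀ {c n} {A : Set c} → Term A n → QF A n
nonzero t = ¬f (t ≐ t𝟎)

splittingFormula : ∀ {c} {A : Set c} → A → A → A → QF A 2
splittingFormula a b₁ b₂ =
  nonzero x₁ ∧ nonzero x₂ ∧
  (par a t- x₁) ≐ x₂ ∧ par b₂ ≼ x₂ ∧
  (par a t- x₂) ≐ x₁ ∧ par b₁ ≼ x₁ ∧
  (par b₂ t- x₁) ≐ (par b₂ t- par b₁) ∧ (par b₁ t- x₂) ≐ (par b₁ t- par b₂)
  where
  x₁ x₂ : Term _ 2
  x₁ = var zero
  x₂ = var (suc zero)

module Splitting {c : Level} (L : CBS c) {a b₁ b₂ : CBS.Carrier L}
                 (b₁∨b₂≪a : CBS._≪_ L (CBS._∨_ L b₁ b₂) a) (a≢𝟎 : a ≢ CBS.𝟎 L) where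
  open CBS L
  open Properties L
  open Dominated L

  b₁≪a : b₁ ≪ a
  b₁≪a = ≤-≪-trans x≤x∨y b₁∨b₂≪a

  b₂≪a : b₂ ≪ a
  b₂≪a = ≤-≪-trans y≤x∨y b₁∨b₂≪a

  ι : Carrier → Triple
  ι = differences b₁ b₂

  a₁ a₂ : Triple
  a₁ = tight 𝟎 a
  a₂ = tight a 𝟎

  ι-a-a₁ : ι a -ᵀ a₁ ≡ a₂
  ι-a-a₁ = trans (-ᵀ-tight (ι a) a₁ y≤x∨y)
    (cong₂ tight (trans x-𝟎≡x (proj₂ b₁≪a)) (x≤y⇒x-y≡𝟎 x-y≤x))

  ι-a-a₂ : ι a -ᵀ a₂ ≡ a₁
  ι-a-a₂ = trans (-ᵀ-tight (ι a) a₂ x≤x∨y)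
    (cong₂ tight (x≤y⇒x-y≡𝟎 x-y≤x) (trans x-𝟎≡x (proj₂ b₂≪a)))

  ιb₁≤a₁ : ι b₁ ≤ᵀ a₁
  ιb₁≤a₁ = ≤ᵀ-componentwise {ι b₁} {a₁}
    (≤-trans (proj₁ b₁≪a) y≤x∨y) (≤-reflexive x-x≡𝟎) (≤-trans x-y≤x (proj₁ b₁≪a))

  ιb₂≤a₂ : ι b₂ ≤ᵀ a₂
  ιb₂≤a₂ = ≤ᵀ-componentwise {ι b₂} {a₂}
    (≤-trans (proj₁ b₂≪a) x≤x∨y) (≤-trans x-y≤x (proj₁ b₂≪a)) (≤-reflexive x-x≡𝟎)

  ι-b₂-a₁ : ι b₂ -ᵀ a₁ ≡ ι b₂ -ᵀ ι b₁
  ι-b₂-a₁ = begin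
    ι b₂ -ᵀ a₁         ≡⟨ -ᵀ-tight (ι b₂) a₁ (≤-trans (proj₁ b₂≪a) y≤x∨y) ⟩
    tight ((b₂ - b₁) - 𝟎) ((b₂ - b₂) - a)
                       ≡⟨ cong₂ tight x-𝟎≡x [x-x]-y≡𝟎 ⟩
    tight (b₂ - b₁) 𝟎  ≡⟨ Triple-≡ (sym (∨-identityʳ _)) ([x-y]-y≡x-y b₂ b₁) (x≤y⇒x-y≡𝟎 x-y≤x) ⟨
    ι (b₂ - b₁)        ≡⟨ differences-− b₁ b₂ b₂ b₁ ⟩
    ι b₂ -ᵀ ι b₁       ∎
    where open ≡-Reasoning

  ι-b₁-a₂ : ι b₁ -ᵀ a₂ ≡ ι b₁ -ᵀ ι b₂
  ι-b₁-a₂ = begin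
    ι b₁ -ᵀ a₂         ≡⟨ -ᵀ-tight (ι b₁) a₂ (≤-trans (proj₁ b₁≪a) x≤x∨y) ⟩
    tight ((b₁ - b₁) - a) ((b₁ - b₂) - 𝟎)
                       ≡⟨ cong₂ tight [x-x]-y≡𝟎 x-𝟎≡x ⟩
    tight 𝟎 (b₁ - b₂)  ≡⟨ Triple-≡ (sym (∨-identityˡ _)) (x≤y⇒x-y≡𝟎 x-y≤x) ([x-y]-y≡x-y b₁ b₂) ⟨
    ι (b₁ - b₂)        ≡⟨ differences-− b₁ b₂ b₁ b₂ ⟩
    ι b₁ -ᵀ ι b₂       ∎
    where open ≡-Reasoning

  witnesses : Fin 2 → Triple
  witnesses zero       = a₁
  witnesses (suc zero) = a₂

  splitsInDominated : Sat (splittingFormula a b₁ b₂) dominated ι witnesses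
  splitsInDominated =
    tight≢𝟎ᵀ (a≢𝟎 ∘ trans (sym (∨-identityˡ a))) ,
    tight≢𝟎ᵀ (a≢𝟎 ∘ trans (sym (∨-identityʳ a))) ,
    ι-a-a₁ , ιb₂≤a₂ , ι-a-a₂ , ιb₁≤a₁ , ι-b₂-a₁ , ι-b₁-a₂

theorem4p2 : ∀ {c : Level} (L : CBS c) → ExistentiallyClosed L → SplittingAxiom L
theorem4p2 L ec a b₁ b₂ b₁∨b₂≪a a≢𝟎 =
  let σ , splitsInL = ec dominated (differencesEmbedding b₁ b₂) 2 (splittingFormula a b₁ b₂)
                        (witnesses , splitsInDominated)
  in σ zero , σ (suc zero) , splitsInL
  where
  open Dominated L
  open Splitting L b₁∨b₂≪a a≢𝟎
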